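{- Let $d\ge1$ and let $a_1,\dots,a_d$ be nonnegative integers. Then every perfect binary tree of depth $a_1+\dots+a_d$ whose vertices are colored with colors $1,2,\dots,d$ contains, for some $i\in[d]$, an essentially $i$-colored subtree of effective depth $a_i$. In other words, $H(a_1,\dots,a_d)\le a_1+\dots+a_d$.
   Context: A perfect binary tree of depth $h$ is a rooted tree in which every non-leaf has two children and there are $2^h$ leaves, all at distance $h$ from the root (a single vertex has depth $0$). Let $T$ be a vertex-colored binary tree and $U$ a subtree of $T$. The effective vertices of $U$ are its root (the vertex of $U$ of smallest depth in $T$), its leaves, and its vertices of degree three in $U$. The effective depth of $U$ is $h_1$, where $h_1+1$ is the minimum number of effective vertices on a path in $U$ from the root of $U$ to a leaf of $U$. $U$ is essentially $i$-colored if all its effective vertices have color $i$. $H(a_1,\dots,a_d)$ denotes the minimal $h$ such that every perfect binary tree of depth $h$ whose vertices are colored with colors $1,\dots,d$ contains an essentially $i$-colored subtree of effective depth $a_i$ for some $i\in[d]$. -}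

module Defs where

open import Data.Nat using (ℕ; zero; suc; _⊔_; _⊓_)
open import Data.Fin using (Fin)
open import Data.Product using (_×_)
open import Data.Unit using (⊤)
open import Relation.Binary.PropositionalEquality using (_≡_)

-- A perfect binary tree of depth h whose vertices are colored with colors
-- from Fin d (colors 1..d are represented by Fin d).
data PTree (d : ℕ) : ℕ → Set where
  leaf : Fin d → PTree d zero
  node : ∀ {h} → Fin d → PTree d h → PTree d h → PTree d (suc h)

colour : ∀ {d h} → PTree d h → Fin d
colour (leaf c)     = c
colour (node c _ _) = c

-- A connected subtree of T containing the root of T (as its own root),
-- described by which children of each vertex belong to the subtree.
-- 'stop' : this vertex has no children in the subtree (a leaf of U).
data Down {d : ℕ} : ∀ {h} → PTree d h → Set where
  stop  : ∀ {h} {T : PTree d h} → Down T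
  goL   : ∀ {h c} {l r : PTree d h} → Down l → Down (node c l r)
  goR   : ∀ {h c} {l r : PTree d h} → Down r → Down (node c l r)
  both  : ∀ {h c} {l r : PTree d h} → Down l → Down r → Down (node c l r)

-- A subtree of T: a connected set of vertices, given by its root vertex v
-- (reached by descending from the root of T) and its shape below v.
data Subtree {d : ℕ} : ∀ {h} → PTree d h → Set where
  here : ∀ {h} {T : PTree d h} → Down T → Subtree T
  inL  : ∀ {h c} {l r : PTree d h} → Subtree l → Subtree (node c l r)
  inR  : ∀ {h c} {l r : PTree d h} → Subtree r → Subtree (node c l r)

-- Non-root vertices of U: effective iff leaf of U (no children in U)
-- or of degree three in U (parent and both children in U).
-- cnt u = minimal number of effective vertices on a path from the vertex
-- (a non-root vertex of U) down to a leaf of U.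
cnt : ∀ {d h} {T : PTree d h} → Down T → ℕ
cnt stop       = 1
cnt (goL u)    = cnt u
cnt (goR u)    = cnt u
cnt (both u v) = suc (cnt u ⊓ cnt v)

-- Minimal number of effective vertices on a root-to-leaf path of U,
-- where the root of U is always effective.
rootCnt : ∀ {d h} {T : PTree d h} → Down T → ℕ
rootCnt stop       = 1
rootCnt (goL u)    = suc (cnt u)
rootCnt (goR u)    = suc (cnt u)
rootCnt (both u v) = suc (cnt u ⊓ cnt v)

-- effective depth h₁ : h₁ + 1 = minimal number of effective vertices
effDepthD : ∀ {d h} {T : PTree d h} → Down T → ℕ
effDepthD u = Data.Nat._∸_ (rootCnt u) 1

effDepth : ∀ {d h} {T : PTree d h} → Subtree T → ℕ
effDepth (here u) = effDepthD u
effDepth (inL s)  = effDepth s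
effDepth (inR s)  = effDepth s

EffColNR : ∀ {d h} {T : PTree d h} → Fin d → Down T → Set
EffColNR {T = T} i stop = colour T ≡ i
EffColNR i (goL u) = EffColNR i u
EffColNR i (goR u) = EffColNR i u
EffColNR {T = node c _ _} i (both u v) = (c ≡ i) × EffColNR i u × EffColNR i v

EffColD : ∀ {d h} {T : PTree d h} → Fin d → Down T → Set
EffColD {T = T} i stop = colour T ≡ i
EffColD {T = node c _ _} i (goL u) = (c ≡ i) × EffColNR i u
EffColD {T = node c _ _} i (goR u) = (c ≡ i) × EffColNR i u
EffColD {T = node c _ _} i (both u v) = (c ≡ i) × EffColNR i u × EffColNR i v

EssColoured : ∀ {d h} {T : PTree d h} → Fin d → Subtree T → Set
EssColoured i (here u) = EffColD i u
EssColoured i (inL s)  = EssColoured i s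
EssColoured i (inR s)  = EssColoured i s

module Submission where

-- Give every colour i a budget aᵢ with Σ aᵢ ≤ h and descend a
-- perfect tree T of depth h from the root, looking for a root-containing
-- shape in which colour i has aᵢ + 1 effective non-root vertices on every
-- branch.  If the budget of the root colour c is 0, the root alone is such a
-- shape.  Otherwise spend one unit of c's budget: the remaining budgets sum
-- to at most h - 1, so each child subtree contains a shape for some colour.
-- If one of them is for a colour i ≠ c, its budget was untouched and we just
-- extend that shape by the edge to the root; if both are for c, joining them
-- at the (c-coloured) root creates a degree-three vertex of colour c, which
-- restores the spent unit.

open import Defs
open import Data.Nat using (ℕ; zero; suc; _+_; _≤_; _⊓_; s≤s⁻¹)
open import Data.Nat.Properties using (≤-refl; ≤-trans; m≤m+n; m≤n+m; +-suc; ⊓-idem; n≤0⇒n≡0; suc-injective)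
open import Data.Fin using (Fin; _≟_) renaming (zero to fzero; suc to fsuc)
open import Data.Vec using (Vec; []; _∷_; sum; lookup; _[_]≔_)
open import Data.Vec.Properties using (lookup∘update; lookup∘update′)
open import Data.Product using (Σ; _×_; ∃; _,_)
open import Relation.Binary.PropositionalEquality using (_≡_; _≢_; refl; sym; trans; cong; cong₂; subst)
open import Relation.Nullary using (yes; no)

lookup≤sum : ∀ {n} (a : Vec ℕ n) (i : Fin n) → lookup a i ≤ sum a
lookup≤sum (x ∷ a) fzero    = m≤m+n x (sum a)
lookup≤sum (x ∷ a) (fsuc i) = ≤-trans (lookup≤sum a i) (m≤n+m (sum a) x)

sum-spend : ∀ {n} (a : Vec ℕ n) (i : Fin n) {x : ℕ} →
  lookup a i ≡ suc x → suc (sum (a [ i ]≔ x)) ≡ sum a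
sum-spend (y ∷ a) fzero    ai≡1+x = cong (_+ sum a) (sym ai≡1+x)
sum-spend (y ∷ a) (fsuc i) ai≡1+x =
  trans (sym (+-suc y _)) (cong (y +_) (sum-spend a i ai≡1+x))

Shape : ∀ {d h} → PTree d h → Fin d → ℕ → Set
Shape T i k = Σ (Down T) λ w → EffColNR i w × cnt w ≡ suc k

extendL : ∀ {d h c} {l r : PTree d h} {i k} → Shape l i k → Shape (node c l r) i k
extendL (w , col , cw) = goL w , col , cw

extendR : ∀ {d h c} {l r : PTree d h} {i k} → Shape r i k → Shape (node c l r) i k
extendR (w , col , cw) = goR w , col , cw

join : ∀ {d h c} {l r : PTree d h} {k} → Shape l c k → Shape r c k →
  Shape (node c l r) c (suc k)
join {k = k} (u , colu , cu) (v , colv , cv) =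
  both u v , (refl , colu , colv) ,
  cong suc (trans (cong₂ _⊓_ cu cv) (⊓-idem (suc k)))

colouredShape : ∀ {d h} (T : PTree d h) (a : Vec ℕ d) → sum a ≤ h →
  ∃ λ i → Shape T i (lookup a i)
colouredShape (leaf c) a Σa≤0 =
  c , stop , refl , cong suc (sym (n≤0⇒n≡0 (≤-trans (lookup≤sum a c) Σa≤0)))
colouredShape {d} {suc h} (node c l r) a Σa≤1+h with lookup a c in ac≡
... | zero  = c , stop , refl , cong suc (sym ac≡)
... | suc x = splitLeft (colouredShape l a′ Σa′≤h)
  where
  a′ : Vec ℕ d
  a′ = a [ c ]≔ x

  Σa′≤h : sum a′ ≤ h
  Σa′≤h = s≤s⁻¹ (subst (_≤ suc h) (sym (sum-spend a c ac≡)) Σa≤1+h)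

  unspent : ∀ {i} (T′ : PTree d h) → i ≢ c →
    Shape T′ i (lookup a′ i) → Shape T′ i (lookup a i)
  unspent {i} _ i≢c = subst (Shape _ i) (lookup∘update′ i≢c a x)

  spentShape : ∀ (T′ : PTree d h) → Shape T′ c (lookup a′ c) → Shape T′ c x
  spentShape _ = subst (Shape _ c) (lookup∘update c a x)

  restored : Shape (node c l r) c (suc x) → Shape (node c l r) c (lookup a c)
  restored = subst (Shape _ c) (sym ac≡)

  splitRight : Shape l c x → ∃ λ i → Shape (node c l r) i (lookup a i)
  splitRight sl with colouredShape r a′ Σa′≤h
  ... | j , sr with j ≟ c
  ...   | no j≢c = j , extendR (unspent r j≢c sr)
  ...   | yes refl = c , restored (join sl (spentShape r sr))

  splitLeft : (∃ λ i → Shape l i (lookup a′ i)) → ∃ λ i → Shape (node c l r) i (lookup a i)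
  splitLeft (i , sl) with i ≟ c
  ... | no i≢c = i , extendL (unspent l i≢c sl)
  ... | yes refl = splitRight (spentShape l sl)

-- Cutting a shape above its first effective non-root vertex yields an
-- essentially i-coloured subtree whose effective depth is one less than cnt.
shapeToSubtree : ∀ {d h} {T : PTree d h} (i : Fin d) (w : Down T) → EffColNR i w →
  Σ (Subtree T) λ U → EssColoured i U × suc (effDepth U) ≡ cnt w
shapeToSubtree i stop       col = here stop , col , refl
shapeToSubtree i (goL w)    col with shapeToSubtree i w col
... | U , colU , dU = inL U , colU , dU
shapeToSubtree i (goR w)    col with shapeToSubtree i w col
... | U , colU , dU = inR U , colU , dU
shapeToSubtree i (both u v) col = here (both u v) , col , refl

lemma1 : (d : ℕ) → 1 ≤ d → (a : Vec ℕ d) → (T : PTree d (sum a)) →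
    ∃ λ (i : Fin d) → Σ (Subtree T) λ U →
      EssColoured i U × effDepth U ≡ lookup a i
lemma1 d _ a T with colouredShape T a ≤-refl
... | i , w , col , cw with shapeToSubtree i w col
...   | U , colU , dU = i , U , colU , suc-injective (trans dU cw)
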